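{- Let $f$ be a non-zero function on the vertex set of a signed hypergraph $\Gamma=(H,\sigma)$. Then for any three pairwise distinct weak nodal domains $D_1,D_2,D_3$ of $f$ (viewed as vertex sets) we have $D_1\cap D_2\cap D_3=\emptyset$.
   Context: A signed hypergraph $\Gamma=(H,\sigma)$: finite hypergraph $H=(V,E)$ with signs $\sigma(v,e)\in\{\pm1\}$ on incidences $v\in e$; $\mathrm{sgn}(e)=(-1)^{|e|-1}\prod_{v\in e}\sigma(v,e)$. For $f:V\to\mathbb{R}$ let $\Omega=\{f\ne0\}$. A W-path of $f$ is a vertex sequence $x_1,\dots,x_\ell$, consecutive vertices lying in common edges $e_t\ni x_t,x_{t+1}$, such that for any two consecutive nonzeros $x_i,x_j$ ($i<j$, $f(x_t)=0$ for $i<t<j$) one has $f(x_i)\mathrm{sgn}(e_i)\cdots\mathrm{sgn}(e_{j-1})f(x_j)>0$. On $\Omega$, $x R_W y$ iff $x=y$ or a W-path connects them; let $W_1,\dots,W_q$ be the equivalence classes. The weak nodal domains are (the induced subhypergraphs on) the sets $W_i^0=W_i\cup\{x\in V:$ there is a W-path from $x$ to some vertex of $W_i\}$.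
   Formalization: The function f takes values in ℚ rather than ℝ. -}

module Defs where

open import Data.Nat as ℕ using (ℕ; zero; suc; _∸_; _%_)
open import Data.Fin using (Fin)
open import Data.Fin.Subset using (Subset; _∈_; ∣_∣)
open import Data.Vec using (lookup)
open import Data.List using (foldr; allFin)
open import Data.Bool using (true; false)
open import Data.Sign as Sign using (Sign)
open import Data.Rational as ℚ using (ℚ; 0ℚ; 1ℚ; -_)
open import Data.Product using (Σ; ∃; _×_)
open import Data.Sum using (_⊎_)
open import Function.Definitions using (Injective)
open import Relation.Binary.PropositionalEquality using (_≡_; _≢_)

-- A (finite) signed hypergraph with vertex set Fin n and edge set indexed
-- (injectively, so E is a genuine set of subsets) by Fin m.
record SignedHypergraph (n m : ℕ) : Set where
  field
    edge     : Fin m → Subset n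
    edgeInj  : Injective _≡_ _≡_ edge
    σ        : Fin n → Fin m → Sign   -- only relevant on incidences v ∈ e

open SignedHypergraph public

σprod : ∀ {n m} → SignedHypergraph n m → Fin m → Sign
σprod {n} Γ e = foldr step Sign.+ (allFin n)
  where
  step : Fin n → Sign → Sign
  step v s with lookup (edge Γ e) v
  ... | true  = σ Γ v e Sign.* s
  ... | false = s

parSign : ℕ → Sign
parSign k with k % 2
... | zero = Sign.-
... | suc _ = Sign.+

-- sgn(e) = (-1)^(|e|-1) ∏_{v∈e} σ(v,e)
sgn : ∀ {n m} → SignedHypergraph n m → Fin m → Sign
sgn Γ e = parSign ∣ edge Γ e ∣ Sign.* σprod Γ e

sgnProd : ∀ {n m} → SignedHypergraph n m → (ℕ → Fin m) → ℕ → ℕ → Sign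
sgnProd Γ es i zero    = Sign.+
sgnProd Γ es i (suc k) = sgn Γ (es i) Sign.* sgnProd Γ es (suc i) k

signℚ : Sign → ℚ
signℚ Sign.+ = 1ℚ
signℚ Sign.- = - 1ℚ

record WPath {n m} (Γ : SignedHypergraph n m) (f : Fin n → ℚ) (a b : Fin n) : Set where
  field
    len   : ℕ
    x     : ℕ → Fin n
    e     : ℕ → Fin m
    start : x 0 ≡ a
    end   : x len ≡ b
    inc   : ∀ t → t ℕ.< len → (x t ∈ edge Γ (e t)) × (x (suc t) ∈ edge Γ (e t))
    cond  : ∀ i j → i ℕ.< j → j ℕ.≤ len →
            f (x i) ≢ 0ℚ → f (x j) ≢ 0ℚ →
            (∀ t → i ℕ.< t → t ℕ.< j → f (x t) ≡ 0ℚ) →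
            0ℚ ℚ.< f (x i) ℚ.* signℚ (sgnProd Γ e i (j ∸ i)) ℚ.* f (x j)

RW : ∀ {n m} → SignedHypergraph n m → (Fin n → ℚ) → Fin n → Fin n → Set
RW Γ f x y = (f x ≢ 0ℚ) × (f y ≢ 0ℚ) × ((x ≡ y) ⊎ WPath Γ f x y)

WClass : ∀ {n m} → SignedHypergraph n m → (Fin n → ℚ) → Fin n → Fin n → Set
WClass Γ f w y = RW Γ f y w

WeakNodalDomain : ∀ {n m} → SignedHypergraph n m → (Fin n → ℚ) → Fin n → Fin n → Set
WeakNodalDomain Γ f w x = WClass Γ f w x ⊎ (∃ λ y → WClass Γ f w y × WPath Γ f x y)

{-# OPTIONS --safe #-}
module Submission where

-- Multiplying f along a walk by the running product of the edge signs (a gauge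
-- transformation) turns the W-path condition into the statement that the gauged
-- values at the non-zero vertices of the walk all have the same sign. Hence
-- W-paths can be reversed, and two W-paths p : a → b and q : b → c can be glued
-- at b as soon as f a and f c, transported to b along p and q, have the same
-- sign. A non-zero vertex of two weak nodal domains forces them to coincide. A
-- zero vertex x of three of them has W-paths to vertices y₁, y₂, y₃ of the three
-- classes; two of the three transported values f yᵢ agree in sign, and gluing
-- the two paths at x shows that those two classes are equal.

open import Defs
open import Data.Nat as ℕ using (ℕ; zero; suc; _+_; _∸_; z≤n; z<s; s<s)
open import Data.Nat.Properties
  using ( ≤-refl; ≤-trans; ≤-total; <⇒≤; <⇒≱; <-≤-trans; <-≤-connex; m≤n⇒m<n∨m≡n
        ; m≤n⇒m≤1+n; n≤1+n; +-suc; +-comm; +-identityʳ; +-cancelˡ-≤; +-cancelˡ-<; +-∸-assoc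
        ; m∸n≤m; m∸n+n≡m; m+[n∸m]≡n; n∸n≡0; ∸-monoʳ-<; m≤n⇒∃[o]m+o≡n)
open import Data.Fin using (Fin)
open import Data.Fin.Subset using (_∈_)
open import Data.Sign as Sign using (Sign)
import Data.Sign.Properties as Signₚ
open import Data.Rational as ℚ using (ℚ; 0ℚ; 1ℚ)
import Data.Rational.Properties as ℚₚ
open import Data.Rational.Solver using (module +-*-Solver)
open import Data.Product using (∃; _×_; _,_)
open import Data.Sum using (_⊎_; inj₁; inj₂)
open import Data.Empty using (⊥-elim)
open import Function.Base using (_∘_)
open import Function.Bundles using (_⇔_; mk⇔)
open import Relation.Binary.Definitions using (tri<; tri≈; tri>)
open import Relation.Nullary using (¬_; yes; no)
open import Relation.Binary.PropositionalEquality
open ≡-Reasoning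

signℚ-* : ∀ s t → signℚ (s Sign.* t) ≡ signℚ s ℚ.* signℚ t
signℚ-* Sign.+ Sign.+ = refl
signℚ-* Sign.+ Sign.- = refl
signℚ-* Sign.- Sign.+ = refl
signℚ-* Sign.- Sign.- = refl

signℚ≢0 : ∀ s → signℚ s ≢ 0ℚ
signℚ≢0 Sign.+ ()
signℚ≢0 Sign.- ()

signℚ-square : ∀ s → signℚ s ℚ.* signℚ s ≡ 1ℚ
signℚ-square Sign.+ = refl
signℚ-square Sign.- = refl

*-signℚ-involutive : ∀ q s → q ℚ.* signℚ s ℚ.* signℚ s ≡ q
*-signℚ-involutive q s = begin
  q ℚ.* signℚ s ℚ.* signℚ s    ≡⟨ ℚₚ.*-assoc q _ _ ⟩
  q ℚ.* (signℚ s ℚ.* signℚ s)  ≡⟨ cong (q ℚ.*_) (signℚ-square s) ⟩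
  q ℚ.* 1ℚ                     ≡⟨ ℚₚ.*-identityʳ q ⟩
  q                            ∎

*-signℚ-absorb : ∀ q s t → q ℚ.* signℚ s ℚ.* signℚ (s Sign.* t) ≡ q ℚ.* signℚ t
*-signℚ-absorb q s t = begin
  q ℚ.* signℚ s ℚ.* signℚ (s Sign.* t)               ≡⟨ cong (q ℚ.* signℚ s ℚ.*_) (signℚ-* s t) ⟩
  q ℚ.* signℚ s ℚ.* (signℚ s ℚ.* signℚ t)            ≡⟨ regroup q (signℚ s) (signℚ t) ⟩
  q ℚ.* signℚ t ℚ.* (signℚ s ℚ.* signℚ s)            ≡⟨ cong (q ℚ.* signℚ t ℚ.*_) (signℚ-square s) ⟩
  q ℚ.* signℚ t ℚ.* 1ℚ                               ≡⟨ ℚₚ.*-identityʳ _ ⟩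
  q ℚ.* signℚ t                                      ∎
  where
  open +-*-Solver
  regroup : ∀ q a b → q ℚ.* a ℚ.* (a ℚ.* b) ≡ q ℚ.* b ℚ.* (a ℚ.* a)
  regroup = solve 3 (λ q a b → q :* a :* (a :* b) := q :* b :* (a :* a)) refl

p*q≢0⇒p≢0 : ∀ {p q} → p ℚ.* q ≢ 0ℚ → p ≢ 0ℚ
p*q≢0⇒p≢0 {q = q} pq≢0 refl = pq≢0 (ℚₚ.*-zeroˡ q)

*-signℚ-≢0 : ∀ {q} s → q ≢ 0ℚ → q ℚ.* signℚ s ≢ 0ℚ
*-signℚ-≢0 {q} s q≢0 qs≡0 = q≢0 (begin
  q                            ≡⟨ *-signℚ-involutive q s ⟨
  q ℚ.* signℚ s ℚ.* signℚ s    ≡⟨ cong (ℚ._* signℚ s) qs≡0 ⟩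
  0ℚ ℚ.* signℚ s               ≡⟨ ℚₚ.*-zeroˡ (signℚ s) ⟩
  0ℚ                           ∎)

<0⊎>0 : ∀ {p} → p ≢ 0ℚ → p ℚ.< 0ℚ ⊎ 0ℚ ℚ.< p
<0⊎>0 {p} p≢0 with ℚₚ.<-cmp p 0ℚ
... | tri< p<0 _ _ = inj₁ p<0
... | tri≈ _ p≡0 _ = ⊥-elim (p≢0 p≡0)
... | tri> _ _ p>0 = inj₂ p>0

data SameSign (p q : ℚ) : Set where
  both>0 : 0ℚ ℚ.< p → 0ℚ ℚ.< q → SameSign p q
  both<0 : p ℚ.< 0ℚ → q ℚ.< 0ℚ → SameSign p q

sameSign-refl : ∀ {p} → p ≢ 0ℚ → SameSign p p
sameSign-refl p≢0 with <0⊎>0 p≢0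
... | inj₁ p<0 = both<0 p<0 p<0
... | inj₂ p>0 = both>0 p>0 p>0

sameSign-sym : ∀ {p q} → SameSign p q → SameSign q p
sameSign-sym (both>0 p>0 q>0) = both>0 q>0 p>0
sameSign-sym (both<0 p<0 q<0) = both<0 q<0 p<0

sameSign-trans : ∀ {p q r} → SameSign p q → SameSign q r → SameSign p r
sameSign-trans (both>0 p>0 _)   (both>0 _ r>0)   = both>0 p>0 r>0
sameSign-trans (both<0 p<0 _)   (both<0 _ r<0)   = both<0 p<0 r<0
sameSign-trans (both>0 _ q>0)   (both<0 q<0 _)   = ⊥-elim (ℚₚ.<-asym q<0 q>0)
sameSign-trans (both<0 _ q<0)   (both>0 q>0 _)   = ⊥-elim (ℚₚ.<-asym q<0 q>0)

sameSign⇒≢0ˡ : ∀ {p q} → SameSign p q → p ≢ 0ℚ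
sameSign⇒≢0ˡ (both>0 p>0 _) refl = ℚₚ.<-irrefl refl p>0
sameSign⇒≢0ˡ (both<0 p<0 _) refl = ℚₚ.<-irrefl refl p<0

sameSign⇒≢0ʳ : ∀ {p q} → SameSign p q → q ≢ 0ℚ
sameSign⇒≢0ʳ = sameSign⇒≢0ˡ ∘ sameSign-sym

sameSign⇒0<* : ∀ {p q} → SameSign p q → 0ℚ ℚ.< p ℚ.* q
sameSign⇒0<* {p} {q} (both>0 p>0 q>0) =
  ℚₚ.positive⁻¹ _ {{ℚₚ.pos*pos⇒pos p {{ℚ.positive p>0}} q {{ℚ.positive q>0}}}}
sameSign⇒0<* {p} {q} (both<0 p<0 q<0) =
  ℚₚ.positive⁻¹ _ {{ℚₚ.neg*neg⇒pos p {{ℚ.negative p<0}} q {{ℚ.negative q<0}}}}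

0<*⇒sameSign : ∀ {p q} → 0ℚ ℚ.< p ℚ.* q → SameSign p q
0<*⇒sameSign {p} {q} pq>0 with <0⊎>0 (p*q≢0⇒p≢0 pq≢0) | <0⊎>0 (p*q≢0⇒p≢0 (pq≢0 ∘ trans (ℚₚ.*-comm p q)))
  where
  pq≢0 : p ℚ.* q ≢ 0ℚ
  pq≢0 pq≡0 = ℚₚ.<-irrefl (sym pq≡0) pq>0
... | inj₂ p>0 | inj₂ q>0 = both>0 p>0 q>0
... | inj₁ p<0 | inj₁ q<0 = both<0 p<0 q<0
... | inj₂ p>0 | inj₁ q<0 =
  ⊥-elim (ℚₚ.<-asym pq>0 (ℚₚ.negative⁻¹ _ {{ℚₚ.pos*neg⇒neg p {{ℚ.positive p>0}} q {{ℚ.negative q<0}}}}))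
... | inj₁ p<0 | inj₂ q>0 =
  ⊥-elim (ℚₚ.<-asym pq>0 (ℚₚ.negative⁻¹ _ {{ℚₚ.neg*pos⇒neg p {{ℚ.negative p<0}} q {{ℚ.positive q>0}}}}))

sameSign-*ʳ : ∀ {p q r} → r ≢ 0ℚ → SameSign p q → SameSign (p ℚ.* r) (q ℚ.* r)
sameSign-*ʳ {p} {q} {r} r≢0 p~q = 0<*⇒sameSign (subst (0ℚ ℚ.<_) (regroup p q r)
  (sameSign⇒0<* (both>0 (sameSign⇒0<* p~q) (sameSign⇒0<* (sameSign-refl r≢0)))))
  where
  open +-*-Solver
  regroup : ∀ p q r → p ℚ.* q ℚ.* (r ℚ.* r) ≡ p ℚ.* r ℚ.* (q ℚ.* r)
  regroup = solve 3 (λ p q r → p :* q :* (r :* r) := p :* r :* (q :* r)) refl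

sameSign-pigeonhole : ∀ {p q r} → p ≢ 0ℚ → q ≢ 0ℚ → r ≢ 0ℚ →
                      SameSign p q ⊎ SameSign p r ⊎ SameSign q r
sameSign-pigeonhole p≢0 q≢0 r≢0 with <0⊎>0 p≢0 | <0⊎>0 q≢0 | <0⊎>0 r≢0
... | inj₂ p>0 | inj₂ q>0 | _        = inj₁ (both>0 p>0 q>0)
... | inj₁ p<0 | inj₁ q<0 | _        = inj₁ (both<0 p<0 q<0)
... | inj₂ p>0 | inj₁ _   | inj₂ r>0 = inj₂ (inj₁ (both>0 p>0 r>0))
... | inj₂ _   | inj₁ q<0 | inj₁ r<0 = inj₂ (inj₂ (both<0 q<0 r<0))
... | inj₁ _   | inj₂ q>0 | inj₂ r>0 = inj₂ (inj₂ (both>0 q>0 r>0))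
... | inj₁ p<0 | inj₂ _   | inj₁ r<0 = inj₂ (inj₁ (both<0 p<0 r<0))

-- At position L this is h 0, which agrees with g L only when the two pieces share that point.
append : ∀ {A : Set} → ℕ → (ℕ → A) → (ℕ → A) → ℕ → A
append zero    g h t       = h t
append (suc L) g h zero    = g zero
append (suc L) g h (suc t) = append L (g ∘ suc) h t

module _ {A : Set} where

  append-< : ∀ L {g h : ℕ → A} {t} → t ℕ.< L → append L g h t ≡ g t
  append-< (suc L) {t = zero}  _         = refl
  append-< (suc L) {t = suc t} (s<s t<L) = append-< L t<L

  append-+ : ∀ L {g h : ℕ → A} u → append L g h (L + u) ≡ h u
  append-+ zero    u = refl
  append-+ (suc L) u = append-+ L u

  append-≤ : ∀ L {g h : ℕ → A} → g L ≡ h 0 → ∀ {t} → t ℕ.≤ L → append L g h t ≡ g t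
  append-≤ L {g} {h} gL≡h0 t≤L with m≤n⇒m<n∨m≡n t≤L
  ... | inj₁ t<L = append-< L t<L
  ... | inj₂ refl = begin
    append L g h L        ≡⟨ cong (append L g h) (+-identityʳ L) ⟨
    append L g h (L + 0)  ≡⟨ append-+ L 0 ⟩
    h 0                   ≡⟨ gL≡h0 ⟨
    g L                   ∎

<⊎≡+ : ∀ L t → t ℕ.< L ⊎ ∃ λ u → L + u ≡ t
<⊎≡+ L t with <-≤-connex t L
... | inj₁ t<L = inj₁ t<L
... | inj₂ L≤t = inj₂ (m≤n⇒∃[o]m+o≡n L≤t)

module _ {n m} (Γ : SignedHypergraph n m) where

  sgnProd-cong : ∀ k {es es' : ℕ → Fin m} {i i'} →
                 (∀ u → u ℕ.< k → es (i + u) ≡ es' (i' + u)) →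
                 sgnProd Γ es i k ≡ sgnProd Γ es' i' k
  sgnProd-cong zero    _ = refl
  sgnProd-cong (suc k) {es} {es'} {i} {i'} es≗es' = cong₂ Sign._*_
    (cong (sgn Γ) (subst₂ (λ u v → es u ≡ es' v) (+-identityʳ i) (+-identityʳ i') (es≗es' 0 z<s)))
    (sgnProd-cong k λ u u<k →
      subst₂ (λ v w → es v ≡ es' w) (+-suc i u) (+-suc i' u) (es≗es' (suc u) (s<s u<k)))

  sgnProd-+ : ∀ a b es i → sgnProd Γ es i (a + b) ≡ sgnProd Γ es i a Sign.* sgnProd Γ es (i + a) b
  sgnProd-+ zero    b es i = cong (λ j → sgnProd Γ es j b) (sym (+-identityʳ i))
  sgnProd-+ (suc a) b es i = begin
    s Sign.* sgnProd Γ es (suc i) (a + b)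
      ≡⟨ cong (s Sign.*_) (sgnProd-+ a b es (suc i)) ⟩
    s Sign.* (sgnProd Γ es (suc i) a Sign.* sgnProd Γ es (suc i + a) b)
      ≡⟨ Signₚ.*-assoc s _ _ ⟨
    s Sign.* sgnProd Γ es (suc i) a Sign.* sgnProd Γ es (suc (i + a)) b
      ≡⟨ cong (λ j → s Sign.* sgnProd Γ es (suc i) a Sign.* sgnProd Γ es j b) (+-suc i a) ⟨
    s Sign.* sgnProd Γ es (suc i) a Sign.* sgnProd Γ es (i + suc a) b
      ∎
    where s = sgn Γ (es i)

  sgnProd-snoc : ∀ k es i → sgnProd Γ es i (suc k) ≡ sgnProd Γ es i k Sign.* sgn Γ (es (i + k))
  sgnProd-snoc k es i = begin
    sgnProd Γ es i (suc k)                                     ≡⟨ cong (sgnProd Γ es i) (+-comm 1 k) ⟩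
    sgnProd Γ es i (k + 1)                                     ≡⟨ sgnProd-+ k 1 es i ⟩
    sgnProd Γ es i k Sign.* (sgn Γ (es (i + k)) Sign.* Sign.+) ≡⟨ cong (sgnProd Γ es i k Sign.*_) (Signₚ.*-identityʳ _) ⟩
    sgnProd Γ es i k Sign.* sgn Γ (es (i + k))                 ∎

  sgnProd-reverse : ∀ k {es es' : ℕ → Fin m} {i i'} →
                    (∀ u → u ℕ.< k → es' (i + u) ≡ es (i' + (k ∸ suc u))) →
                    sgnProd Γ es' i k ≡ sgnProd Γ es i' k
  sgnProd-reverse zero    _ = refl
  sgnProd-reverse (suc k) {es} {es'} {i} {i'} es'≗rev = begin
    sgn Γ (es' i) Sign.* sgnProd Γ es' (suc i) k
      ≡⟨ cong₂ Sign._*_ (cong (sgn Γ) (subst (λ j → es' j ≡ es (i' + k)) (+-identityʳ i) (es'≗rev 0 z<s)))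
                        (sgnProd-reverse k λ u u<k →
                          subst (λ j → es' j ≡ es (i' + (k ∸ suc u))) (+-suc i u) (es'≗rev (suc u) (s<s u<k))) ⟩
    sgn Γ (es (i' + k)) Sign.* sgnProd Γ es i' k
      ≡⟨ Signₚ.*-comm (sgn Γ (es (i' + k))) (sgnProd Γ es i' k) ⟩
    sgnProd Γ es i' k Sign.* sgn Γ (es (i' + k))
      ≡⟨ sgnProd-snoc k es i' ⟨
    sgnProd Γ es i' (suc k)
      ∎

  sgnProd-reversed : ∀ {E : ℕ → Fin m} {L t} → t ℕ.≤ L →
                     sgnProd Γ (λ u → E (L ∸ suc u)) 0 t ≡ sgnProd Γ E (L ∸ t) t
  sgnProd-reversed {E} {L} {t} t≤L = sgnProd-reverse t λ u u<t → cong E (begin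
    L ∸ suc u            ≡⟨ cong (_∸ suc u) (m∸n+n≡m t≤L) ⟨
    (L ∸ t + t) ∸ suc u  ≡⟨ +-∸-assoc (L ∸ t) u<t ⟩
    L ∸ t + (t ∸ suc u)  ∎)

  ∈-edge-cong : ∀ {v v' e e'} → v ≡ v' → e ≡ e' → v ∈ edge Γ e → v' ∈ edge Γ e'
  ∈-edge-cong refl refl v∈e = v∈e

module _ {n m} (Γ : SignedHypergraph n m) (f : Fin n → ℚ) where

  -- The value of f at the t-th vertex, transported to the start of the walk.
  gauge : (ℕ → Fin n) → (ℕ → Fin m) → ℕ → ℚ
  gauge X E t = f (X t) ℚ.* signℚ (sgnProd Γ E 0 t)

  WCondition : (ℕ → Fin n) → (ℕ → Fin m) → ℕ → Set
  WCondition X E L = ∀ i j → i ℕ.< j → j ℕ.≤ L → f (X i) ≢ 0ℚ → f (X j) ≢ 0ℚ →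
    (∀ t → i ℕ.< t → t ℕ.< j → f (X t) ≡ 0ℚ) →
    0ℚ ℚ.< f (X i) ℚ.* signℚ (sgnProd Γ E i (j ∸ i)) ℚ.* f (X j)

  Coherent : (ℕ → Fin n) → (ℕ → Fin m) → ℕ → Set
  Coherent X E L = ∀ {i j} → i ℕ.≤ L → j ℕ.≤ L → f (X i) ≢ 0ℚ → f (X j) ≢ 0ℚ →
    SameSign (gauge X E i) (gauge X E j)

  Incident : (ℕ → Fin n) → (ℕ → Fin m) → ℕ → Set
  Incident X E L = ∀ t → t ℕ.< L → (X t ∈ edge Γ (E t)) × (X (suc t) ∈ edge Γ (E t))

  module _ {X : ℕ → Fin n} {E : ℕ → Fin m} where

    gauge-0 : gauge X E 0 ≡ f (X 0)
    gauge-0 = ℚₚ.*-identityʳ _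

    gauge-≢0 : ∀ {t} → f (X t) ≢ 0ℚ → gauge X E t ≢ 0ℚ
    gauge-≢0 {t} = *-signℚ-≢0 (sgnProd Γ E 0 t)

    gauge-product : ∀ {i j} → i ℕ.≤ j →
      f (X i) ℚ.* signℚ (sgnProd Γ E i (j ∸ i)) ℚ.* f (X j) ≡ gauge X E i ℚ.* gauge X E j
    gauge-product {i} {j} i≤j = begin
      f (X i) ℚ.* signℚ B ℚ.* f (X j)                   ≡⟨ regroup (f (X i)) _ (f (X j)) ⟩
      f (X i) ℚ.* f (X j) ℚ.* signℚ B                   ≡⟨ *-signℚ-absorb (f (X i) ℚ.* f (X j)) A B ⟨
      f (X i) ℚ.* f (X j) ℚ.* signℚ A ℚ.* signℚ (A Sign.* B)
        ≡⟨ cong (λ s → f (X i) ℚ.* f (X j) ℚ.* signℚ A ℚ.* signℚ s) split ⟨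
      f (X i) ℚ.* f (X j) ℚ.* signℚ A ℚ.* signℚ (sgnProd Γ E 0 j)
        ≡⟨ interleave (f (X i)) (f (X j)) _ _ ⟩
      gauge X E i ℚ.* gauge X E j                       ∎
      where
      A = sgnProd Γ E 0 i
      B = sgnProd Γ E i (j ∸ i)
      split : sgnProd Γ E 0 j ≡ A Sign.* B
      split = trans (cong (sgnProd Γ E 0) (sym (m+[n∸m]≡n i≤j))) (sgnProd-+ Γ i (j ∸ i) E 0)
      open +-*-Solver
      regroup : ∀ a s b → a ℚ.* s ℚ.* b ≡ a ℚ.* b ℚ.* s
      regroup = solve 3 (λ a s b → a :* s :* b := a :* b :* s) refl
      interleave : ∀ a b s t → a ℚ.* b ℚ.* s ℚ.* t ≡ a ℚ.* s ℚ.* (b ℚ.* t)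
      interleave = solve 4 (λ a b s t → a :* b :* s :* t := a :* s :* (b :* t)) refl

    coherent⇒wCondition : ∀ {L} → Coherent X E L → WCondition X E L
    coherent⇒wCondition coh i j i<j j≤L fXi≢0 fXj≢0 _ =
      subst (0ℚ ℚ.<_) (sym (gauge-product (<⇒≤ i<j)))
            (sameSign⇒0<* (coh (≤-trans (<⇒≤ i<j) j≤L) j≤L fXi≢0 fXj≢0))

    nothingBetween : ∀ {k} t → k ℕ.< t → t ℕ.≤ k → f (X t) ≡ 0ℚ
    nothingBetween t k<t t≤k = ⊥-elim (<⇒≱ k<t t≤k)

    lastNonzero : ∀ {L} → WCondition X E L → ∀ {i} j → i ℕ.≤ j → j ℕ.≤ L → f (X i) ≢ 0ℚ →
      ∃ λ k → k ℕ.≤ j × f (X k) ≢ 0ℚ × (∀ t → k ℕ.< t → t ℕ.≤ j → f (X t) ≡ 0ℚ) ×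
              SameSign (gauge X E i) (gauge X E k)
    lastNonzero cond {i} j i≤j j≤L fXi≢0 with m≤n⇒m<n∨m≡n i≤j
    ... | inj₂ refl = i , ≤-refl , fXi≢0 , nothingBetween , sameSign-refl (gauge-≢0 fXi≢0)
    lastNonzero cond (suc j) _ 1+j≤L fXi≢0 | inj₁ (s<s i≤j)
      with lastNonzero cond j i≤j (≤-trans (n≤1+n j) 1+j≤L) fXi≢0 | f (X (suc j)) ℚ.≟ 0ℚ
    ... | k , k≤j , fXk≢0 , zeros , i~k | yes fX1+j≡0 = k , m≤n⇒m≤1+n k≤j , fXk≢0 , zeros′ , i~k
      where
      zeros′ : ∀ t → k ℕ.< t → t ℕ.≤ suc j → f (X t) ≡ 0ℚ
      zeros′ t k<t t≤1+j with m≤n⇒m<n∨m≡n t≤1+j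
      ... | inj₁ (s<s t≤j) = zeros t k<t t≤j
      ... | inj₂ refl      = fX1+j≡0
    ... | k , k≤j , fXk≢0 , zeros , i~k | no fX1+j≢0 =
      suc j , ≤-refl , fX1+j≢0 , nothingBetween , sameSign-trans i~k k~1+j
      where
      k~1+j : SameSign (gauge X E k) (gauge X E (suc j))
      k~1+j = 0<*⇒sameSign (subst (0ℚ ℚ.<_) (gauge-product (m≤n⇒m≤1+n k≤j))
        (cond k (suc j) (s<s k≤j) 1+j≤L fXk≢0 fX1+j≢0 λ t k<t t<1+j → zeros t k<t (ℕ.s≤s⁻¹ t<1+j)))

    sameSign-rightwards : ∀ {L} → WCondition X E L → ∀ {i j} → i ℕ.≤ j → j ℕ.≤ L →
      f (X i) ≢ 0ℚ → f (X j) ≢ 0ℚ → SameSign (gauge X E i) (gauge X E j)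
    sameSign-rightwards cond {j = j} i≤j j≤L fXi≢0 fXj≢0 with lastNonzero cond j i≤j j≤L fXi≢0
    ... | k , k≤j , _ , zeros , i~k with m≤n⇒m<n∨m≡n k≤j
    ...   | inj₁ k<j  = ⊥-elim (fXj≢0 (zeros j k<j ≤-refl))
    ...   | inj₂ refl = i~k

    wCondition⇒coherent : ∀ {L} → WCondition X E L → Coherent X E L
    wCondition⇒coherent cond {i} {j} i≤L j≤L fXi≢0 fXj≢0 with ≤-total i j
    ... | inj₁ i≤j = sameSign-rightwards cond i≤j j≤L fXi≢0 fXj≢0
    ... | inj₂ j≤i = sameSign-sym (sameSign-rightwards cond j≤i i≤L fXj≢0 fXi≢0)

    coherent-fromAnchor : ∀ {L ρ} → (∀ {t} → t ℕ.≤ L → f (X t) ≢ 0ℚ → SameSign (gauge X E t) ρ) →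
                          Coherent X E L
    coherent-fromAnchor t~ρ i≤L j≤L fXi≢0 fXj≢0 =
      sameSign-trans (t~ρ i≤L fXi≢0) (sameSign-sym (t~ρ j≤L fXj≢0))

    module _ {L : ℕ} where

      gauge-reverse : ∀ {t} → t ℕ.≤ L →
        gauge (λ t → X (L ∸ t)) (λ u → E (L ∸ suc u)) t ≡ gauge X E (L ∸ t) ℚ.* signℚ (sgnProd Γ E 0 L)
      gauge-reverse {t} t≤L = begin
        f (X (L ∸ t)) ℚ.* signℚ (sgnProd Γ (λ u → E (L ∸ suc u)) 0 t)
          ≡⟨ cong (λ s → f (X (L ∸ t)) ℚ.* signℚ s) (sgnProd-reversed Γ t≤L) ⟩
        f (X (L ∸ t)) ℚ.* signℚ B
          ≡⟨ *-signℚ-absorb (f (X (L ∸ t))) A B ⟨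
        f (X (L ∸ t)) ℚ.* signℚ A ℚ.* signℚ (A Sign.* B)
          ≡⟨ cong (λ s → f (X (L ∸ t)) ℚ.* signℚ A ℚ.* signℚ s) split ⟨
        f (X (L ∸ t)) ℚ.* signℚ A ℚ.* signℚ (sgnProd Γ E 0 L)
          ∎
        where
        A = sgnProd Γ E 0 (L ∸ t)
        B = sgnProd Γ E (L ∸ t) t
        split : sgnProd Γ E 0 L ≡ A Sign.* B
        split = trans (cong (sgnProd Γ E 0) (sym (m∸n+n≡m t≤L))) (sgnProd-+ Γ (L ∸ t) t E 0)

      coherent-reverse : Coherent X E L → Coherent (λ t → X (L ∸ t)) (λ u → E (L ∸ suc u)) L
      coherent-reverse coh {i} {j} i≤L j≤L fXi≢0 fXj≢0 =
        subst₂ SameSign (sym (gauge-reverse i≤L)) (sym (gauge-reverse j≤L))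
          (sameSign-*ʳ (signℚ≢0 (sgnProd Γ E 0 L)) (coh (m∸n≤m L i) (m∸n≤m L j) fXi≢0 fXj≢0))

      incident-reverse : Incident X E L → Incident (λ t → X (L ∸ t)) (λ u → E (L ∸ suc u)) L
      incident-reverse inc t t<L with inc (L ∸ suc t) (∸-monoʳ-< z<s t<L)
      ... | x∈e , x′∈e = ∈-edge-cong Γ (cong X (sym (+-∸-assoc 1 t<L))) refl x′∈e , x∈e

  module _ {xp xq : ℕ → Fin n} {ep eq : ℕ → Fin m} {Lp : ℕ} where

    sgnProd-append-< : ∀ {t} → t ℕ.≤ Lp → sgnProd Γ (append Lp ep eq) 0 t ≡ sgnProd Γ ep 0 t
    sgnProd-append-< {t} t≤Lp = sgnProd-cong Γ t λ u u<t → append-< Lp (<-≤-trans u<t t≤Lp)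

    sgnProd-append-+ : ∀ u →
      sgnProd Γ (append Lp ep eq) 0 (Lp + u) ≡ sgnProd Γ ep 0 Lp Sign.* sgnProd Γ eq 0 u
    sgnProd-append-+ u = trans (sgnProd-+ Γ Lp u (append Lp ep eq) 0)
      (cong₂ Sign._*_ (sgnProd-append-< ≤-refl) (sgnProd-cong Γ u λ v _ → append-+ Lp v))

    gauge-append-< : ∀ {t} → t ℕ.< Lp → gauge (append Lp xp xq) (append Lp ep eq) t ≡ gauge xp ep t
    gauge-append-< t<Lp =
      cong₂ (λ v s → f v ℚ.* signℚ s) (append-< Lp t<Lp) (sgnProd-append-< (<⇒≤ t<Lp))

    gauge-append-+ : ∀ u → gauge (append Lp xp xq) (append Lp ep eq) (Lp + u) ≡
                           gauge xq eq u ℚ.* signℚ (sgnProd Γ ep 0 Lp)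
    gauge-append-+ u = begin
      f (append Lp xp xq (Lp + u)) ℚ.* signℚ (sgnProd Γ (append Lp ep eq) 0 (Lp + u))
        ≡⟨ cong₂ (λ v s → f v ℚ.* signℚ s) (append-+ Lp u) (sgnProd-append-+ u) ⟩
      f (xq u) ℚ.* signℚ (P Sign.* Q)
        ≡⟨ cong (f (xq u) ℚ.*_) (signℚ-* P Q) ⟩
      f (xq u) ℚ.* (signℚ P ℚ.* signℚ Q)
        ≡⟨ swap (f (xq u)) (signℚ P) (signℚ Q) ⟩
      f (xq u) ℚ.* signℚ Q ℚ.* signℚ P
        ∎
      where
      P = sgnProd Γ ep 0 Lp
      Q = sgnProd Γ eq 0 u
      open +-*-Solver
      swap : ∀ a p q → a ℚ.* (p ℚ.* q) ≡ a ℚ.* q ℚ.* p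
      swap = solve 3 (λ a p q → a :* (p :* q) := a :* q :* p) refl

    -- Every non-zero vertex of the glued walk has the gauge sign of its first vertex.
    coherent-append : ∀ {Lq} → Coherent xp ep Lp → Coherent xq eq Lq →
      SameSign (f (xp 0) ℚ.* signℚ (sgnProd Γ ep 0 Lp)) (f (xq Lq) ℚ.* signℚ (sgnProd Γ eq 0 Lq)) →
      Coherent (append Lp xp xq) (append Lp ep eq) (Lp + Lq)
    coherent-append {Lq} cohp cohq ends = coherent-fromAnchor anchored
      where
      P = sgnProd Γ ep 0 Lp
      anchored : ∀ {t} → t ℕ.≤ Lp + Lq → f (append Lp xp xq t) ≢ 0ℚ →
                 SameSign (gauge (append Lp xp xq) (append Lp ep eq) t) (f (xp 0))
      anchored {t} _ fXt≢0 with <⊎≡+ Lp t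
      ... | inj₁ t<Lp =
        subst₂ SameSign (sym (gauge-append-< t<Lp)) (gauge-0 {xp} {ep})
          (cohp (<⇒≤ t<Lp) z≤n (fXt≢0 ∘ trans (cong f (append-< Lp t<Lp)))
                (p*q≢0⇒p≢0 (sameSign⇒≢0ˡ ends)))
      anchored t≤L fXt≢0 | inj₂ (u , refl) = sameSign-trans
        (subst (λ g → SameSign g _) (sym (gauge-append-+ u))
          (sameSign-*ʳ (signℚ≢0 P)
            (cohq (+-cancelˡ-≤ Lp u Lq t≤L) ≤-refl (fXt≢0 ∘ trans (cong f (append-+ Lp u)))
                  (p*q≢0⇒p≢0 (sameSign⇒≢0ʳ ends)))))
        (subst (SameSign _) (*-signℚ-involutive (f (xp 0)) P)
          (sameSign-sym (sameSign-*ʳ (signℚ≢0 P) ends)))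

    incident-append : ∀ {Lq} → xp Lp ≡ xq 0 → Incident xp ep Lp → Incident xq eq Lq →
                      Incident (append Lp xp xq) (append Lp ep eq) (Lp + Lq)
    incident-append {Lq} junction incp incq t t<L with <⊎≡+ Lp t
    ... | inj₁ t<Lp with incp t t<Lp
    ...   | x∈e , x′∈e =
      ∈-edge-cong Γ (sym (append-< Lp t<Lp)) (sym (append-< Lp t<Lp)) x∈e ,
      ∈-edge-cong Γ (sym (append-≤ Lp junction t<Lp)) (sym (append-< Lp t<Lp)) x′∈e
    incident-append {Lq} junction incp incq t t<L | inj₂ (u , refl)
      with incq u (+-cancelˡ-< Lp u Lq t<L)
    ...   | x∈e , x′∈e =
      ∈-edge-cong Γ (sym (append-+ Lp u)) (sym (append-+ Lp u)) x∈e ,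
      ∈-edge-cong Γ (sym (trans (cong (append Lp xp xq) (sym (+-suc Lp u))) (append-+ Lp (suc u))))
                    (sym (append-+ Lp u)) x′∈e

  module _ {a b : Fin n} (p : WPath Γ f a b) where
    open WPath p

    coherent : Coherent x e len
    coherent = wCondition⇒coherent cond

    pathSign : Sign
    pathSign = sgnProd Γ e 0 len

    endpoints-sameSign : f a ≢ 0ℚ → f b ≢ 0ℚ → SameSign (f a) (f b ℚ.* signℚ pathSign)
    endpoints-sameSign fa≢0 fb≢0 =
      subst₂ SameSign (trans (gauge-0 {x} {e}) (cong f start)) (cong (λ v → f v ℚ.* signℚ pathSign) end)
        (coherent z≤n ≤-refl (fa≢0 ∘ trans (cong f (sym start))) (fb≢0 ∘ trans (cong f (sym end))))

    reverse : WPath Γ f b a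
    reverse = record
      { len   = len
      ; x     = λ t → x (len ∸ t)
      ; e     = λ u → e (len ∸ suc u)
      ; start = end
      ; end   = trans (cong x (n∸n≡0 len)) start
      ; inc   = incident-reverse inc
      ; cond  = coherent⇒wCondition (coherent-reverse coherent)
      }

  pathSign-reverse : ∀ {a b} (p : WPath Γ f a b) → pathSign (reverse p) ≡ pathSign p
  pathSign-reverse p =
    trans (sgnProd-reversed Γ {e} {len} ≤-refl) (cong (λ i → sgnProd Γ e i len) (n∸n≡0 len))
    where open WPath p

  -- The hypothesis compares f a and f c as seen from the junction b.
  glue : ∀ {a b c} (p : WPath Γ f a b) (q : WPath Γ f b c) →
         SameSign (f a ℚ.* signℚ (pathSign p)) (f c ℚ.* signℚ (pathSign q)) → WPath Γ f a c
  glue p q ends = record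
    { len   = P.len + Q.len
    ; x     = append P.len P.x Q.x
    ; e     = append P.len P.e Q.e
    ; start = trans (append-≤ P.len junction z≤n) P.start
    ; end   = trans (append-+ P.len Q.len) Q.end
    ; inc   = incident-append junction P.inc Q.inc
    ; cond  = coherent⇒wCondition (coherent-append (coherent p) (coherent q)
                (subst₂ (λ u v → SameSign (f u ℚ.* signℚ (pathSign p)) (f v ℚ.* signℚ (pathSign q)))
                        (sym P.start) (sym Q.end) ends))
    }
    where
    module P = WPath p
    module Q = WPath q
    junction : P.x P.len ≡ Q.x 0
    junction = trans P.end (sym Q.start)

  glue-nonzero : ∀ {a b c} → f a ≢ 0ℚ → f b ≢ 0ℚ → f c ≢ 0ℚ →
                 WPath Γ f a b → WPath Γ f b c → WPath Γ f a c
  glue-nonzero {b = b} fa≢0 fb≢0 fc≢0 p q =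
    glue p q (sameSign-trans a~b (endpoints-sameSign q fb≢0 fc≢0))
    where
    a~b : SameSign (f _ ℚ.* signℚ (pathSign p)) (f b)
    a~b = subst (SameSign _) (*-signℚ-involutive (f b) (pathSign p))
            (sameSign-*ʳ (signℚ≢0 (pathSign p)) (endpoints-sameSign p fa≢0 fb≢0))

  join : ∀ {x b c} (p : WPath Γ f x b) (q : WPath Γ f x c) →
         SameSign (f b ℚ.* signℚ (pathSign p)) (f c ℚ.* signℚ (pathSign q)) → WPath Γ f b c
  join {b = b} p q b~c =
    glue (reverse p) q (subst (λ s → SameSign (f b ℚ.* signℚ s) _) (sym (pathSign-reverse p)) b~c)

  RW-sym : ∀ {a b} → RW Γ f a b → RW Γ f b a
  RW-sym (fa≢0 , fb≢0 , inj₁ a≡b) = fb≢0 , fa≢0 , inj₁ (sym a≡b)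
  RW-sym (fa≢0 , fb≢0 , inj₂ p)   = fb≢0 , fa≢0 , inj₂ (reverse p)

  RW-trans : ∀ {a b c} → RW Γ f a b → RW Γ f b c → RW Γ f a c
  RW-trans (_ , _ , inj₁ refl) b~c = b~c
  RW-trans (fa≢0 , _ , inj₂ p) (_ , fc≢0 , inj₁ refl) = fa≢0 , fc≢0 , inj₂ p
  RW-trans (fa≢0 , fb≢0 , inj₂ p) (_ , fc≢0 , inj₂ q) = fa≢0 , fc≢0 , inj₂ (glue-nonzero fa≢0 fb≢0 fc≢0 p q)

  weakNodalDomain-⊆ : ∀ {w₁ w₂} → RW Γ f w₁ w₂ →
                      ∀ x → WeakNodalDomain Γ f w₁ x → WeakNodalDomain Γ f w₂ x
  weakNodalDomain-⊆ w₁~w₂ x (inj₁ x~w₁)             = inj₁ (RW-trans x~w₁ w₁~w₂)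
  weakNodalDomain-⊆ w₁~w₂ x (inj₂ (y , y~w₁ , x⇝y)) = inj₂ (y , RW-trans y~w₁ w₁~w₂ , x⇝y)

  weakNodalDomain-cong : ∀ {w₁ w₂} → RW Γ f w₁ w₂ →
                         ∀ x → WeakNodalDomain Γ f w₁ x ⇔ WeakNodalDomain Γ f w₂ x
  weakNodalDomain-cong w₁~w₂ x = mk⇔ (weakNodalDomain-⊆ w₁~w₂ x) (weakNodalDomain-⊆ (RW-sym w₁~w₂) x)

  nonzero-member⇒RW : ∀ {w x} → f x ≢ 0ℚ → WeakNodalDomain Γ f w x → RW Γ f x w
  nonzero-member⇒RW _     (inj₁ x~w)             = x~w
  nonzero-member⇒RW fx≢0 (inj₂ (y , y~w@(fy≢0 , _) , x⇝y)) = RW-trans (fx≢0 , fy≢0 , inj₂ x⇝y) y~w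

  zero-member⇒path : ∀ {w x} → f x ≡ 0ℚ → WeakNodalDomain Γ f w x → ∃ λ y → RW Γ f y w × WPath Γ f x y
  zero-member⇒path fx≡0 (inj₁ (fx≢0 , _)) = ⊥-elim (fx≢0 fx≡0)
  zero-member⇒path _    (inj₂ y~w⇝)       = y~w⇝

  sharedNonzeroVertex : ∀ {w₁ w₂ x} → f x ≢ 0ℚ →
    WeakNodalDomain Γ f w₁ x → WeakNodalDomain Γ f w₂ x → RW Γ f w₁ w₂
  sharedNonzeroVertex fx≢0 x∈D₁ x∈D₂ =
    RW-trans (RW-sym (nonzero-member⇒RW fx≢0 x∈D₁)) (nonzero-member⇒RW fx≢0 x∈D₂)

  transported≢0 : ∀ {x y w} → RW Γ f y w → (p : WPath Γ f x y) → f y ℚ.* signℚ (pathSign p) ≢ 0ℚ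
  transported≢0 (fy≢0 , _) p = *-signℚ-≢0 (pathSign p) fy≢0

  RW-join : ∀ {x y₁ y₂ w₁ w₂} → RW Γ f y₁ w₁ → RW Γ f y₂ w₂ →
    (p₁ : WPath Γ f x y₁) (p₂ : WPath Γ f x y₂) →
    SameSign (f y₁ ℚ.* signℚ (pathSign p₁)) (f y₂ ℚ.* signℚ (pathSign p₂)) → RW Γ f w₁ w₂
  RW-join y₁~w₁@(fy₁≢0 , _) y₂~w₂@(fy₂≢0 , _) p₁ p₂ y₁~y₂ =
    RW-trans (RW-sym y₁~w₁) (RW-trans (fy₁≢0 , fy₂≢0 , inj₂ (join p₁ p₂ y₁~y₂)) y₂~w₂)

  sharedZeroVertex : ∀ {w₁ w₂ w₃ x} → f x ≡ 0ℚ →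
    WeakNodalDomain Γ f w₁ x → WeakNodalDomain Γ f w₂ x → WeakNodalDomain Γ f w₃ x →
    RW Γ f w₁ w₂ ⊎ RW Γ f w₁ w₃ ⊎ RW Γ f w₂ w₃
  sharedZeroVertex fx≡0 x∈D₁ x∈D₂ x∈D₃
    with zero-member⇒path fx≡0 x∈D₁ | zero-member⇒path fx≡0 x∈D₂ | zero-member⇒path fx≡0 x∈D₃
  ... | _ , y₁~w₁ , p₁ | _ , y₂~w₂ , p₂ | _ , y₃~w₃ , p₃
    with sameSign-pigeonhole (transported≢0 y₁~w₁ p₁) (transported≢0 y₂~w₂ p₂) (transported≢0 y₃~w₃ p₃)
  ... | inj₁ y₁~y₂        = inj₁ (RW-join y₁~w₁ y₂~w₂ p₁ p₂ y₁~y₂)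
  ... | inj₂ (inj₁ y₁~y₃) = inj₂ (inj₁ (RW-join y₁~w₁ y₃~w₃ p₁ p₃ y₁~y₃))
  ... | inj₂ (inj₂ y₂~y₃) = inj₂ (inj₂ (RW-join y₂~w₂ y₃~w₃ p₂ p₃ y₂~y₃))

proposition3p8 : ∀ {n m} (Γ : SignedHypergraph n m) (f : Fin n → ℚ) →
    ¬ (∀ v → f v ≡ 0ℚ) →
    (w₁ w₂ w₃ : Fin n) → f w₁ ≢ 0ℚ → f w₂ ≢ 0ℚ → f w₃ ≢ 0ℚ →
    ¬ (∀ x → WeakNodalDomain Γ f w₁ x ⇔ WeakNodalDomain Γ f w₂ x) →
    ¬ (∀ x → WeakNodalDomain Γ f w₁ x ⇔ WeakNodalDomain Γ f w₃ x) →
    ¬ (∀ x → WeakNodalDomain Γ f w₂ x ⇔ WeakNodalDomain Γ f w₃ x) →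
    ¬ (∃ λ x → WeakNodalDomain Γ f w₁ x × WeakNodalDomain Γ f w₂ x × WeakNodalDomain Γ f w₃ x)
proposition3p8 Γ f _ _ _ _ _ _ _ D₁≉D₂ D₁≉D₃ D₂≉D₃ (x , x∈D₁ , x∈D₂ , x∈D₃) with f x ℚ.≟ 0ℚ
... | no fx≢0 = D₁≉D₂ (weakNodalDomain-cong Γ f (sharedNonzeroVertex Γ f fx≢0 x∈D₁ x∈D₂))
... | yes fx≡0 with sharedZeroVertex Γ f fx≡0 x∈D₁ x∈D₂ x∈D₃
...   | inj₁ w₁~w₂        = D₁≉D₂ (weakNodalDomain-cong Γ f w₁~w₂)
...   | inj₂ (inj₁ w₁~w₃) = D₁≉D₃ (weakNodalDomain-cong Γ f w₁~w₃)
...   | inj₂ (inj₂ w₂~w₃) = D₂≉D₃ (weakNodalDomain-cong Γ f w₂~w₃)
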